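{- Let $k\ge 1$ and let $v$ be a fixed vertex of the infinite $3$-regular tree. The number of $k$-vertex subtrees of the infinite $3$-regular tree containing $v$ equals $$\frac{3}{2k+1}\binom{2k+1}{k-1}=\mathcal{C}(k+1)-\mathcal{C}(k),$$ where $\mathcal{C}(m)=\frac{1}{m+1}\binom{2m}{m}$ denotes the $m$-th Catalan number.
   Context: A subtree is a connected subgraph; a $k$-vertex subtree has exactly $k$ vertices. -}

module Defs where

open import Data.Nat using (ℕ; suc; _*_; _+_; _/_; _∸_)
open import Data.Nat.Combinatorics using (_C_)
open import Data.Fin using (Fin)
open import Data.List using (List; []; _∷_; length)
open import Data.List.Membership.Propositional using (_∈_)
open import Data.List.Relation.Unary.All using (All)
open import Data.List.Relation.Unary.AllPairs using (AllPairs)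
open import Data.List.Relation.Unary.Unique.Propositional using (Unique)
open import Data.List.Relation.Binary.Permutation.Propositional using (_↭_)
open import Data.Product using (Σ; _×_; ∃)
open import Relation.Binary.PropositionalEquality using (_≡_; _≢_)
open import Relation.Nullary using (¬_)

-- The infinite 3-regular tree is the Cayley graph of Z/2 * Z/2 * Z/2:
-- vertices are reduced words over the alphabet Fin 3 (no two consecutive
-- letters equal); u and x ∷ u are adjacent.
Word : Set
Word = List (Fin 3)

data Reduced : Word → Set where
  red-[]  : Reduced []
  red-[x] : ∀ x → Reduced (x ∷ [])
  red-∷   : ∀ {x y w} → x ≢ y → Reduced (y ∷ w) → Reduced (x ∷ y ∷ w)

-- adjacency in the tree (both words are assumed reduced)
data Adj : Word → Word → Set where
  down : ∀ x u → Adj u (x ∷ u)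
  up   : ∀ x u → Adj (x ∷ u) u

data PathIn (S : List Word) : Word → Word → Set where
  here : ∀ {a} → PathIn S a a
  step : ∀ {a c b} → Adj a c → c ∈ S → PathIn S c b → PathIn S a b

IsSubtreeAt : ℕ → Word → List Word → Set
IsSubtreeAt k v S =
  All Reduced S × Unique S × length S ≡ k × v ∈ S ×
  (∀ {u} → u ∈ S → PathIn S v u)

Enumerates : ℕ → Word → List (List Word) → Set
Enumerates k v Ts =
  All (IsSubtreeAt k v) Ts ×
  AllPairs (λ S T → ¬ (S ↭ T)) Ts ×
  (∀ S → IsSubtreeAt k v S → ∃ λ T → T ∈ Ts × S ↭ T)

catalan : ℕ → ℕ
catalan m = ((2 * m) C m) / suc m

-- Right multiplication by v is an automorphism of the Cayley graph sending the root [] to v, so it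
-- suffices to count the subtrees containing []. Ordering vertices by "is a suffix of", these are the
-- nonempty suffix-closed sets of reduced words. Such a set is grown from the three neighbours of [] by
-- deciding, slot by slot, whether the slot is occupied; an occupied slot is replaced by its two
-- children. The number F r n of n-vertex forests planted at r slots therefore satisfies
-- F (r+1) (n+1) = F r (n+1) + F (r+2) n, the recurrence Pascal's rule gives for
-- C(2n+r+1, n+1) − C(2n+r+1, n); absorption then yields (2n+r) F r n = r C(2n+r, n). The k-vertex
-- subtrees are counted by F 3 (k−1), the Catalan numbers are F 1, and unfolding the recurrence twice
-- gives F 1 (k+1) = F 1 k + F 3 (k−1).
module Submission where

open import Defs
open import Data.Empty using (⊥-elim)
open import Data.Fin as Fin using (Fin)
open import Data.Fin.Properties using (_≟_)
open import Data.List using (List; []; _∷_; _++_; _∷ʳ_; length; map; filter; foldl; reverse; allFin)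
open import Data.List.Properties
  using (length-map; length-++; ++-assoc; ++-identityʳ; foldl-∷ʳ; unfold-reverse; reverse-involutive;
         ∷-injectiveˡ; ≡-dec)
open import Data.List.Membership.Propositional using (_∈_; _∉_; lose)
open import Data.List.Membership.Propositional.Properties
  using (∈-map⁺; ∈-map⁻; ∈-++⁺ˡ; ∈-++⁺ʳ; ∈-++⁻; ∈-∃++; ∈-filter⁺; ∈-filter⁻; ∈-allFin)
open import Data.List.Membership.DecPropositional (≡-dec (_≟_ {3})) using (_∈?_)
open import Data.List.Relation.Unary.All as All using (All; []; _∷_)
import Data.List.Relation.Unary.All.Properties as Allₚ
open import Data.List.Relation.Unary.Any as Any using (Any; here; there)
import Data.List.Relation.Unary.Any.Properties as Anyₚ
open import Data.List.Relation.Unary.AllPairs as AllPairs using (AllPairs; []; _∷_)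
import Data.List.Relation.Unary.AllPairs.Properties as AllPairsₚ
open import Data.List.Relation.Unary.Unique.Propositional using (Unique)
open import Data.List.Relation.Unary.Unique.Propositional.Properties using (allFin⁺; filter⁺)
open import Data.List.Relation.Binary.Permutation.Propositional using (_↭_; ↭-refl; ↭-sym; ↭-trans; ↭-prep; ↭⇒↭ₛ)
open import Data.List.Relation.Binary.Permutation.Propositional.Properties
  using (All-resp-↭; ∈-resp-↭; drop-∷; shift; ↭-length)
import Data.List.Relation.Binary.Permutation.Propositional.Properties as ↭ₚ
open import Data.Nat using (ℕ; zero; suc; _*_; _+_; _/_; _∸_; _≤_; s≤s; NonZero)
open import Data.Nat.Properties
  using (≤-refl; ≤-antisym; <-irrefl; m≤n⇒m≤1+n; m≤m+n; m+n∸m≡n; +-comm; +-identityʳ; *-zeroʳ;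
         *-identityˡ; *-identityʳ; *-distribˡ-+; +-cancelʳ-≡; *-cancelˡ-≡; suc-injective)
open import Data.Nat.Combinatorics using (_C_; nC1≡n; nCk≡nC[n∸k]; nCk+nC[k+1]≡[n+1]C[k+1])
open import Data.Nat.DivMod using (m*n/n≡m)
open import Data.Nat.Tactic.RingSolver using (solve-∀)
open import Data.Product as Prod using (Σ; _×_; _,_; proj₁; proj₂; ∃; uncurry)
open import Data.Sum using (_⊎_; inj₁; inj₂; [_,_]′)
open import Data.Unit using (⊤; tt)
open import Function using (id)
open import Relation.Nullary using (¬_; yes; no; ¬?)
open import Relation.Nullary.Decidable using (toSum)
open import Relation.Unary using (Decidable)
open import Relation.Binary.PropositionalEquality
open import Relation.Binary.PropositionalEquality.Properties using (setoid)
import Data.List.Relation.Binary.Permutation.Setoid.Properties (setoid Word) as ↭ₛ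
open ≡-Reasoning

-- Ballot numbers

-- The number of n-vertex forests planted at r free slots of the rooted binary tree.
forestCount : ℕ → ℕ → ℕ
forestCount r       zero    = 1
forestCount zero    (suc n) = 0
forestCount (suc r) (suc n) = forestCount r (suc n) + forestCount (suc (suc r)) n

forestCount-1-vertex : ∀ r → forestCount r 1 ≡ r
forestCount-1-vertex zero    = refl
forestCount-1-vertex (suc r) = trans (cong (_+ 1) (forestCount-1-vertex r)) (+-comm r 1)

[k+1]*[n+1]C[k+1]≡[n+1]*nCk : ∀ n k → suc k * (suc n C suc k) ≡ suc n * (n C k)
[k+1]*[n+1]C[k+1]≡[n+1]*nCk zero    zero    = refl
[k+1]*[n+1]C[k+1]≡[n+1]*nCk zero    (suc k) = *-zeroʳ (suc (suc k))
[k+1]*[n+1]C[k+1]≡[n+1]*nCk (suc n) zero    =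
  trans (*-identityˡ (suc (suc n) C 1)) (trans (nC1≡n (suc (suc n))) (sym (*-identityʳ (suc (suc n)))))
[k+1]*[n+1]C[k+1]≡[n+1]*nCk (suc n) (suc k) = begin
  suc (suc k) * (suc (suc n) C suc (suc k))   ≡⟨ cong (suc (suc k) *_) (nCk+nC[k+1]≡[n+1]C[k+1] (suc n) (suc k)) ⟨
  suc (suc k) * (a + b)                       ≡⟨ *-distribˡ-+ (suc (suc k)) a b ⟩
  a + suc k * a + suc (suc k) * b             ≡⟨ cong₂ (λ x y → a + x + y) ([k+1]*[n+1]C[k+1]≡[n+1]*nCk n k)
                                                                          ([k+1]*[n+1]C[k+1]≡[n+1]*nCk n (suc k)) ⟩
  a + suc n * (n C k) + suc n * (n C suc k)   ≡⟨ factor a n (n C k) (n C suc k) ⟩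
  a + suc n * (n C k + n C suc k)             ≡⟨ cong (λ x → a + suc n * x) (nCk+nC[k+1]≡[n+1]C[k+1] n k) ⟩
  a + suc n * a                               ∎
  where
  a b : ℕ
  a = suc n C suc k
  b = suc n C suc (suc k)
  factor : ∀ a n x y → a + suc n * x + suc n * y ≡ a + suc n * (x + y)
  factor = solve-∀

[2n+1]C[n+1]≡[2n+1]Cn : ∀ n → suc (2 * n) C suc n ≡ suc (2 * n) C n
[2n+1]C[n+1]≡[2n+1]Cn n =
  trans (nCk≡nC[n∸k] (s≤s (m≤m+n n (n + 0))))
        (cong (suc (2 * n) C_) (trans (m+n∸m≡n n (n + 0)) (+-identityʳ n)))

forestCount-difference : ∀ r n → forestCount r (suc n) + suc (r + 2 * n) C n ≡ suc (r + 2 * n) C suc n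
forestCount-difference zero    n       = sym ([2n+1]C[n+1]≡[2n+1]Cn n)
forestCount-difference (suc r) zero    = begin
  forestCount r 1 + 1 + 1   ≡⟨ cong (λ x → x + 1 + 1) (forestCount-1-vertex r) ⟩
  r + 1 + 1                 ≡⟨ index r ⟩
  suc (suc (r + 0))         ≡⟨ nC1≡n _ ⟨
  suc (suc r + 0) C 1       ∎
  where
  index : ∀ r → r + 1 + 1 ≡ suc (suc (r + 0))
  index = solve-∀
forestCount-difference (suc r) (suc n) =
  pascal-step (suc (r + 2 * suc n)) n (forestCount-difference r (suc n))
    (subst (λ P → forestCount (suc (suc r)) (suc n) + P C n ≡ P C suc n) (index r n)
           (forestCount-difference (suc (suc r)) n))
  where
  index : ∀ r n → suc (suc (suc r) + 2 * n) ≡ suc (r + 2 * suc n)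
  index = solve-∀
  -- By Pascal's rule the right-hand side minus the binomial on the left obeys the recurrence of forestCount.
  pascal-step : ∀ P k {a b} → a + P C suc k ≡ P C suc (suc k) → b + P C k ≡ P C suc k →
                a + b + suc P C suc k ≡ suc P C suc (suc k)
  pascal-step P k {a} {b} ha hb = begin
    a + b + suc P C suc k             ≡⟨ cong (a + b +_) (nCk+nC[k+1]≡[n+1]C[k+1] P k) ⟨
    a + b + (P C k + P C suc k)       ≡⟨ regroup a b (P C k) (P C suc k) ⟩
    (a + P C suc k) + (b + P C k)     ≡⟨ cong₂ _+_ ha hb ⟩
    P C suc (suc k) + P C suc k       ≡⟨ +-comm (P C suc (suc k)) _ ⟩
    P C suc k + P C suc (suc k)       ≡⟨ nCk+nC[k+1]≡[n+1]C[k+1] P (suc k) ⟩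
    suc P C suc (suc k)               ∎
    where
    regroup : ∀ a b c d → a + b + (c + d) ≡ (a + d) + (b + c)
    regroup = solve-∀

-- Pascal's rule and absorption give (M + 1) (C(M, n+1) − C(M, n)) = (M + 1 − 2 (n + 1)) C(M+1, n+1).
difference⇒product : ∀ r n {f} → f + (2 + r + 2 * n) C n ≡ (2 + r + 2 * n) C suc n →
                     f * (3 + r + 2 * n) ≡ suc r * ((3 + r + 2 * n) C suc n)
difference⇒product r n {f} f+X≡Y = +-cancelʳ-≡ (suc n * Z + suc n * Z) _ _ (begin
  f * suc M + (suc n * Z + suc n * Z)   ≡⟨ cong (λ t → f * suc M + (t + suc n * Z)) absorb ⟩
  f * suc M + (suc M * X + suc n * Z)   ≡⟨ regroup f M X (suc n * Z) ⟩
  suc M * (f + X) + suc n * Z           ≡⟨ cong (λ t → suc M * t + suc n * Z) f+X≡Y ⟩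
  suc M * Y + suc n * Z                 ≡⟨ cong (suc M * Y +_) absorb ⟩
  suc M * Y + suc M * X                 ≡⟨ *-distribˡ-+ (suc M) Y X ⟨
  suc M * (Y + X)                       ≡⟨ cong (suc M *_) (trans (+-comm Y X) (nCk+nC[k+1]≡[n+1]C[k+1] M n)) ⟩
  suc M * Z                             ≡⟨ split r n Z ⟩
  suc r * Z + (suc n * Z + suc n * Z)   ∎)
  where
  M X Y Z : ℕ
  M = 2 + r + 2 * n
  X = M C n
  Y = M C suc n
  Z = suc M C suc n
  absorb : suc n * Z ≡ suc M * X
  absorb = [k+1]*[n+1]C[k+1]≡[n+1]*nCk M n
  regroup : ∀ f M X z → f * suc M + (suc M * X + z) ≡ suc M * (f + X) + z
  regroup = solve-∀
  split : ∀ r n Z → (3 + r + 2 * n) * Z ≡ suc r * Z + (suc n * Z + suc n * Z)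
  split = solve-∀

forestCount-closed : ∀ r n → forestCount r n * (r + 2 * n) ≡ r * ((r + 2 * n) C n)
forestCount-closed r       zero    = trans (*-identityˡ (r + 0)) (trans (+-identityʳ r) (sym (*-identityʳ r)))
forestCount-closed zero    (suc n) = refl
forestCount-closed (suc r) (suc n) =
  subst (λ N → forestCount (suc r) (suc n) * N ≡ suc r * (N C suc n)) (index r n)
    (difference⇒product r n (forestCount-difference (suc r) n))
  where
  index : ∀ r n → 3 + r + 2 * n ≡ suc r + 2 * suc n
  index = solve-∀

m*n≡o⇒m≡o/n : ∀ m n {o} .{{_ : NonZero n}} → m * n ≡ o → m ≡ o / n
m*n≡o⇒m≡o/n m n refl = sym (m*n/n≡m m n)

catalan≡forestCount-1-slot : ∀ m → catalan m ≡ forestCount 1 m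
catalan≡forestCount-1-slot m = sym (m*n≡o⇒m≡o/n (forestCount 1 m) (suc m) (*-cancelˡ-≡ _ _ (suc (2 * m)) (begin
  suc (2 * m) * (forestCount 1 m * suc m)  ≡⟨ swap (2 * m) m (forestCount 1 m) ⟩
  suc m * (forestCount 1 m * suc (2 * m))  ≡⟨ cong (suc m *_) (trans (forestCount-closed 1 m) (*-identityˡ _)) ⟩
  suc m * (suc (2 * m) C m)                ≡⟨ cong (suc m *_) ([2n+1]C[n+1]≡[2n+1]Cn m) ⟨
  suc m * (suc (2 * m) C suc m)            ≡⟨ [k+1]*[n+1]C[k+1]≡[n+1]*nCk (2 * m) m ⟩
  suc (2 * m) * ((2 * m) C m)              ∎)))
  where
  swap : ∀ a b c → suc a * (c * suc b) ≡ suc b * (c * suc a)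
  swap = solve-∀

forestCount-3-slots : ∀ m → forestCount 3 m ≡ (3 * ((2 * suc m + 1) C m)) / suc (2 * suc m)
forestCount-3-slots m = m*n≡o⇒m≡o/n (forestCount 3 m) (suc (2 * suc m))
  (subst₂ (λ N N′ → forestCount 3 m * N ≡ 3 * (N′ C m)) (index₁ m) (index₂ m) (forestCount-closed 3 m))
  where
  index₁ : ∀ m → 3 + 2 * m ≡ suc (2 * suc m)
  index₁ = solve-∀
  index₂ : ∀ m → 3 + 2 * m ≡ 2 * suc m + 1
  index₂ = solve-∀

catalan-difference : ∀ m → catalan (suc (suc m)) ∸ catalan (suc m) ≡ forestCount 3 m
catalan-difference m =
  trans (cong₂ _∸_ (catalan≡forestCount-1-slot (suc (suc m))) (catalan≡forestCount-1-slot (suc m)))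
        (m+n∸m≡n (forestCount 1 (suc m)) (forestCount 3 m))

-- Ancestry in the tree rooted at []

-- s ≼ u: s lies on the path from [] to u, i.e. s is a suffix of u.
infix 4 _≼_

data _≼_ : Word → Word → Set where
  ≼-refl : ∀ {u} → u ≼ u
  ≼-∷    : ∀ {s x u} → s ≼ u → s ≼ x ∷ u

≼-length : ∀ {s u} → s ≼ u → length s ≤ length u
≼-length ≼-refl  = ≤-refl
≼-length (≼-∷ p) = m≤n⇒m≤1+n (≼-length p)

≼-trans : ∀ {a b c} → a ≼ b → b ≼ c → a ≼ c
≼-trans p ≼-refl  = p
≼-trans p (≼-∷ q) = ≼-∷ (≼-trans p q)

[]≼ : ∀ u → [] ≼ u
[]≼ []      = ≼-refl
[]≼ (x ∷ u) = ≼-∷ ([]≼ u)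

≼[]⇒≡[] : ∀ {s} → s ≼ [] → s ≡ []
≼[]⇒≡[] ≼-refl = refl

parent-≼ : ∀ {x w s} → x ∷ w ≼ s → w ≼ s
parent-≼ = ≼-trans (≼-∷ ≼-refl)

x∷w⋠w : ∀ {x w} → ¬ (x ∷ w ≼ w)
x∷w⋠w p = <-irrefl refl (≼-length p)

≼∧≡length⇒≡ : ∀ {s u} → s ≼ u → length s ≡ length u → s ≡ u
≼∧≡length⇒≡ ≼-refl  _ = refl
≼∧≡length⇒≡ (≼-∷ p) e = ⊥-elim (<-irrefl e (s≤s (≼-length p)))

≼-antisym : ∀ {a b} → a ≼ b → b ≼ a → a ≡ b
≼-antisym p q = ≼∧≡length⇒≡ p (≤-antisym (≼-length p) (≼-length q))

≼-total : ∀ {a b u} → a ≼ u → b ≼ u → a ≼ b ⊎ b ≼ a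
≼-total ≼-refl  q       = inj₂ q
≼-total (≼-∷ p) ≼-refl  = inj₁ (≼-∷ p)
≼-total (≼-∷ p) (≼-∷ q) = ≼-total p q

≼-child : ∀ {w s} → w ≼ s → s ≡ w ⊎ ∃ λ x → x ∷ w ≼ s
≼-child ≼-refl = inj₁ refl
≼-child (≼-∷ {x = x} p) with ≼-child p
... | inj₁ refl     = inj₂ (x , ≼-refl)
... | inj₂ (y , q)  = inj₂ (y , ≼-∷ q)

reduced-tail : ∀ {x u} → Reduced (x ∷ u) → Reduced u
reduced-tail (red-[x] _) = red-[]
reduced-tail (red-∷ _ r) = r

reduced-≼ : ∀ {s u} → Reduced u → s ≼ u → Reduced s
reduced-≼ r ≼-refl  = r
reduced-≼ r (≼-∷ p) = reduced-≼ (reduced-tail r) p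

Incomparable : Word → Word → Set
Incomparable a b = ¬ a ≼ b × ¬ b ≼ a

siblings-incomparable : ∀ {a b w} → a ≢ b → Incomparable (a ∷ w) (b ∷ w)
siblings-incomparable a≢b =
  (λ p → a≢b (∷-injectiveˡ (≼∧≡length⇒≡ p refl))) , (λ p → a≢b (sym (∷-injectiveˡ (≼∧≡length⇒≡ p refl))))

incomparable-child : ∀ {x w w′} → Incomparable w w′ → Incomparable (x ∷ w) w′
incomparable-child (w⋠w′ , w′⋠w) =
  (λ p → w⋠w′ (parent-≼ p)) , λ { ≼-refl → w⋠w′ (≼-∷ ≼-refl) ; (≼-∷ q) → w′⋠w q }

-- x ∷ w is a child of w (a reduced word when w is) exactly when Fresh w x.
Fresh : Word → Fin 3 → Set
Fresh []      x = ⊤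
Fresh (y ∷ _) x = x ≢ y

fresh? : ∀ w → Decidable (Fresh w)
fresh? []      x = yes tt
fresh? (y ∷ _) x = ¬? (x ≟ y)

reduced-∷ : ∀ {x w} → Reduced w → Fresh w x → Reduced (x ∷ w)
reduced-∷ {w = []}    _ _   = red-[x] _
reduced-∷ {w = _ ∷ _} r x≢y = red-∷ x≢y r

reduced⇒fresh : ∀ {x w} → Reduced (x ∷ w) → Fresh w x
reduced⇒fresh (red-[x] _)   = tt
reduced⇒fresh (red-∷ x≢y _) = x≢y

children : Word → List Word
children w = map (_∷ w) (filter (fresh? w) (allFin 3))

∈-children : ∀ {x w} → Fresh w x → x ∷ w ∈ children w
∈-children {x} {w} fx = ∈-map⁺ (_∷ w) (∈-filter⁺ (fresh? w) (∈-allFin x) fx)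

children-reduced : ∀ {w} → Reduced w → All Reduced (children w)
children-reduced {w} r = Allₚ.map⁺ (All.tabulate λ x∈ → reduced-∷ r (proj₂ (∈-filter⁻ (fresh? w) x∈)))

children-incomparable : ∀ w → AllPairs Incomparable (children w)
children-incomparable w = AllPairsₚ.map⁺ (AllPairs.map siblings-incomparable (filter⁺ (fresh? w) (allFin⁺ 3)))

children-nonempty : ∀ w → All (_≢ []) (children w)
children-nonempty w = Allₚ.map⁺ (All.tabulate λ _ ())

children-length : ∀ {w} → w ≢ [] → length (children w) ≡ 2
children-length {[]}                             w≢[] = ⊥-elim (w≢[] refl)
children-length {Fin.zero ∷ _}                   _    = refl
children-length {Fin.suc Fin.zero ∷ _}           _    = refl
children-length {Fin.suc (Fin.suc Fin.zero) ∷ _} _    = refl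

Below : List Word → Word → Set
Below ws s = Any (_≼ s) ws

below-children⇒≼ : ∀ {w s} → Below (children w) s → w ≼ s
below-children⇒≼ b = parent-≼ (proj₂ (Any.satisfied (Anyₚ.map⁻ b)))

¬below-children-self : ∀ {w} → ¬ Below (children w) w
¬below-children-self b = x∷w⋠w (proj₂ (Any.satisfied (Anyₚ.map⁻ b)))

child≼⇒below-children : ∀ {x w s} → Reduced s → x ∷ w ≼ s → Below (children w) s
child≼⇒below-children rs p = lose (∈-children (reduced⇒fresh (reduced-≼ rs p))) p

-- Forests planted at an antichain of slots

Antichain : List Word → Set
Antichain ws = All Reduced ws × AllPairs Incomparable ws

antichain-tail : ∀ {w ws} → Antichain (w ∷ ws) → Antichain ws
antichain-tail (_ ∷ rs , _ ∷ ps) = rs , ps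

antichain-children : ∀ {w ws} → Antichain (w ∷ ws) → Antichain (children w ++ ws)
antichain-children {w} (rw ∷ rs , w# ∷ ps) =
  Allₚ.++⁺ (children-reduced rw) rs ,
  AllPairsₚ.++⁺ (children-incomparable w) ps (Allₚ.map⁺ (All.tabulate λ _ → All.map incomparable-child w#))

below⇒⋠slot : ∀ {w ws s} → All (Incomparable w) ws → Below ws s → ¬ s ≼ w
below⇒⋠slot (w# ∷ _)  (here w′≼s) s≼w = proj₂ w# (≼-trans w′≼s s≼w)
below⇒⋠slot (_ ∷ ws#) (there b)   s≼w = below⇒⋠slot ws# b s≼w

below⇒slot⋠ : ∀ {w ws u} → All (Incomparable w) ws → Below ws u → ¬ w ≼ u
below⇒slot⋠ (w# ∷ _)  (here w′≼u) w≼u = [ proj₂ w# , proj₁ w# ]′ (≼-total w′≼u w≼u)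
below⇒slot⋠ (_ ∷ ws#) (there b)   w≼u = below⇒slot⋠ ws# b w≼u

below-parent : ∀ {w ws s} → Below (children w ++ ws) s → Below (w ∷ ws) s
below-parent {w} b with Anyₚ.++⁻ (children w) b
... | inj₁ c = here (below-children⇒≼ c)
... | inj₂ c = there c

¬below-slot : ∀ {w ws} → All (Incomparable w) ws → ¬ Below (children w ++ ws) w
¬below-slot {w} w# b with Anyₚ.++⁻ (children w) b
... | inj₁ c = ¬below-children-self c
... | inj₂ c = below⇒⋠slot w# c ≼-refl

record PlantedAt (ws S : List Word) : Set where
  field
    reduced : All Reduced S
    unique  : Unique S
    below   : All (Below ws) S
    closed  : ∀ {u s} → u ∈ S → s ≼ u → Below ws s → s ∈ S

unique-resp-↭ : ∀ {S T : List Word} → S ↭ T → Unique S → Unique T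
unique-resp-↭ σ = ↭ₛ.Unique-resp-↭ (↭⇒↭ₛ σ)

planted-resp-↭ : ∀ {ws S T} → S ↭ T → PlantedAt ws S → PlantedAt ws T
planted-resp-↭ σ p = record
  { reduced = All-resp-↭ σ reduced
  ; unique  = unique-resp-↭ σ unique
  ; below   = All-resp-↭ σ below
  ; closed  = λ u∈T s≼u b → ∈-resp-↭ σ (closed (∈-resp-↭ (↭-sym σ) u∈T) s≼u b)
  }
  where open PlantedAt p

planted-skip⁺ : ∀ {w ws S} → Antichain (w ∷ ws) → PlantedAt ws S → PlantedAt (w ∷ ws) S
planted-skip⁺ {w} {ws} {S} (_ , w# ∷ _) p = record
  { reduced = reduced ; unique = unique ; below = All.map there below ; closed = closed′ }
  where
  open PlantedAt p
  closed′ : ∀ {u s} → u ∈ S → s ≼ u → Below (w ∷ ws) s → s ∈ S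
  closed′ u∈S s≼u (here w≼s) = ⊥-elim (below⇒slot⋠ w# (All.lookup below u∈S) (≼-trans w≼s s≼u))
  closed′ u∈S s≼u (there b)  = closed u∈S s≼u b

planted-skip⁻ : ∀ {w ws S} → PlantedAt (w ∷ ws) S → w ∉ S → PlantedAt ws S
planted-skip⁻ {w} {ws} {S} p w∉S = record
  { reduced = reduced ; unique = unique ; below = All.tabulate below′
  ; closed = λ u∈S s≼u b → closed u∈S s≼u (there b) }
  where
  open PlantedAt p
  below′ : ∀ {u} → u ∈ S → Below ws u
  below′ u∈S with All.lookup below u∈S
  ... | here w≼u = ⊥-elim (w∉S (closed u∈S w≼u (here ≼-refl)))
  ... | there b  = b

planted-take⁺ : ∀ {w ws S} → Antichain (w ∷ ws) → PlantedAt (children w ++ ws) S → PlantedAt (w ∷ ws) (w ∷ S)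
planted-take⁺ {w} {ws} {S} (rw ∷ _ , w# ∷ _) p = record
  { reduced = rw ∷ reduced
  ; unique  = All.tabulate (λ u∈S w≡u → ¬below-slot w# (subst (Below _) (sym w≡u) (All.lookup below u∈S))) ∷ unique
  ; below   = here ≼-refl ∷ All.map below-parent below
  ; closed  = closed′
  }
  where
  open PlantedAt p
  closed′ : ∀ {u s} → u ∈ w ∷ S → s ≼ u → Below (w ∷ ws) s → s ∈ w ∷ S
  closed′ (here refl) s≼w (here w≼s) = here (≼-antisym s≼w w≼s)
  closed′ (here refl) s≼w (there b)  = ⊥-elim (below⇒⋠slot w# b s≼w)
  closed′ (there u∈S) s≼u (here w≼s) with ≼-child w≼s
  ... | inj₁ s≡w         = here s≡w
  ... | inj₂ (_ , x∷w≼s) =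
    there (closed u∈S s≼u (Anyₚ.++⁺ˡ (child≼⇒below-children (reduced-≼ (All.lookup reduced u∈S) s≼u) x∷w≼s)))
  closed′ (there u∈S) s≼u (there b)  = there (closed u∈S s≼u (Anyₚ.++⁺ʳ (children w) b))

planted-take⁻ : ∀ {w ws S} → Antichain (w ∷ ws) → PlantedAt (w ∷ ws) (w ∷ S) → PlantedAt (children w ++ ws) S
planted-take⁻ {w} {ws} {S} (_ , w# ∷ _) p = record
  { reduced = All.tail reduced ; unique = AllPairs.tail unique ; below = All.tabulate below′ ; closed = closed′ }
  where
  open PlantedAt p
  below′ : ∀ {u} → u ∈ S → Below (children w ++ ws) u
  below′ u∈S with All.lookup below (there u∈S)
  ... | there b  = Anyₚ.++⁺ʳ (children w) b
  ... | here w≼u with ≼-child w≼u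
  ...   | inj₁ refl        = ⊥-elim (All.lookup (AllPairs.head unique) u∈S refl)
  ...   | inj₂ (_ , x∷w≼u) = Anyₚ.++⁺ˡ (child≼⇒below-children (All.lookup reduced (there u∈S)) x∷w≼u)
  closed′ : ∀ {u s} → u ∈ S → s ≼ u → Below (children w ++ ws) s → s ∈ S
  closed′ u∈S s≼u b with closed (there u∈S) s≼u (below-parent b)
  ... | here refl = ⊥-elim (¬below-slot w# b)
  ... | there s∈S = s∈S

planted-[] : ∀ {ws} → PlantedAt ws []
planted-[] = record { reduced = [] ; unique = [] ; below = [] ; closed = λ () }

forestsAt : List Word → ℕ → List (List Word)
forestsAt ws       zero    = [] ∷ []
forestsAt []       (suc n) = []
forestsAt (w ∷ ws) (suc n) = forestsAt ws (suc n) ++ map (w ∷_) (forestsAt (children w ++ ws) n)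

forestsAt-sound : ∀ ws n {T} → Antichain ws → T ∈ forestsAt ws n → PlantedAt ws T × length T ≡ n
forestsAt-sound ws       zero    _ (here refl) = planted-[] , refl
forestsAt-sound []       (suc n) _ ()
forestsAt-sound (w ∷ ws) (suc n) a T∈ with ∈-++⁻ (forestsAt ws (suc n)) T∈
... | inj₁ T∈₁ = Prod.map₁ (planted-skip⁺ a) (forestsAt-sound ws (suc n) (antichain-tail a) T∈₁)
... | inj₂ T∈₂ with ∈-map⁻ (w ∷_) T∈₂
...   | _ , T′∈ , refl =
  Prod.map (planted-take⁺ a) (cong suc) (forestsAt-sound (children w ++ ws) n (antichain-children a) T′∈)

∈⇒↭-∷ : ∀ {A : Set} {x : A} {xs} → x ∈ xs → ∃ λ ys → xs ↭ x ∷ ys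
∈⇒↭-∷ {x = x} x∈xs with ∈-∃++ x∈xs
... | ys , zs , refl = ys ++ zs , shift x ys zs

forestsAt-complete : ∀ ws n {S} → Antichain ws → PlantedAt ws S → length S ≡ n →
                     ∃ λ T → T ∈ forestsAt ws n × S ↭ T
forestsAt-complete ws       zero    {[]}    _ _ _ = [] , here refl , ↭-refl
forestsAt-complete ws       zero    {_ ∷ _} _ _ ()
forestsAt-complete []       (suc n) {[]}    _ _ ()
forestsAt-complete []       (suc n) {_ ∷ _} _ p _ with PlantedAt.below p
... | () ∷ _
forestsAt-complete (w ∷ ws) (suc n) {S} a p |S|≡ =
  [ (λ w∈S →
      let (S′ , σ)     = ∈⇒↭-∷ w∈S
          (T , T∈ , ρ) = forestsAt-complete (children w ++ ws) n (antichain-children a)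
                           (planted-take⁻ a (planted-resp-↭ σ p)) (suc-injective (trans (sym (↭-length σ)) |S|≡))
      in w ∷ T , ∈-++⁺ʳ (forestsAt ws (suc n)) (∈-map⁺ (w ∷_) T∈) , ↭-trans σ (↭-prep w ρ))
  , (λ w∉S →
      Prod.map₂ (Prod.map₁ ∈-++⁺ˡ) (forestsAt-complete ws (suc n) (antichain-tail a) (planted-skip⁻ p w∉S) |S|≡))
  ]′ (toSum (w ∈? S))

forestsAt-distinct : ∀ ws n → Antichain ws → AllPairs (λ S T → ¬ (S ↭ T)) (forestsAt ws n)
forestsAt-distinct ws       zero    _ = [] ∷ []
forestsAt-distinct []       (suc n) _ = []
-- The forests in the two halves of the list differ in whether they contain the slot w.
forestsAt-distinct (w ∷ ws) (suc n) a@(_ , w# ∷ _) =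
  AllPairsₚ.++⁺ (forestsAt-distinct ws (suc n) (antichain-tail a))
    (AllPairsₚ.map⁺ (AllPairs.map ¬↭-∷ (forestsAt-distinct (children w ++ ws) n (antichain-children a))))
    (All.tabulate λ T∈ → All.map (λ w∈T′ T↭T′ → slot∉ T∈ (∈-resp-↭ (↭-sym T↭T′) w∈T′)) slot∈)
  where
  ¬↭-∷ : ∀ {S T} → ¬ (S ↭ T) → ¬ (w ∷ S ↭ w ∷ T)
  ¬↭-∷ ¬S↭T w∷S↭w∷T = ¬S↭T (drop-∷ w∷S↭w∷T)
  slot∈ : All (w ∈_) (map (w ∷_) (forestsAt (children w ++ ws) n))
  slot∈ = Allₚ.map⁺ (All.tabulate λ _ → here refl)
  slot∉ : ∀ {T} → T ∈ forestsAt ws (suc n) → w ∉ T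
  slot∉ T∈ w∈T =
    below⇒⋠slot w# (All.lookup (PlantedAt.below (proj₁ (forestsAt-sound ws (suc n) (antichain-tail a) T∈))) w∈T)
                ≼-refl

forestsAt-length : ∀ ws n → All (_≢ []) ws → length (forestsAt ws n) ≡ forestCount (length ws) n
forestsAt-length ws       zero    _ = refl
forestsAt-length []       (suc n) _ = refl
forestsAt-length (w ∷ ws) (suc n) (w≢[] ∷ ne) = begin
  length (forestsAt ws (suc n) ++ map (w ∷_) (forestsAt (children w ++ ws) n))
    ≡⟨ length-++ (forestsAt ws (suc n)) ⟩
  length (forestsAt ws (suc n)) + length (map (w ∷_) (forestsAt (children w ++ ws) n))
    ≡⟨ cong₂ _+_ (forestsAt-length ws (suc n) ne) (length-map (w ∷_) (forestsAt (children w ++ ws) n)) ⟩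
  forestCount (length ws) (suc n) + length (forestsAt (children w ++ ws) n)
    ≡⟨ cong (forestCount (length ws) (suc n) +_)
            (forestsAt-length (children w ++ ws) n (Allₚ.++⁺ (children-nonempty w) ne)) ⟩
  forestCount (length ws) (suc n) + forestCount (length (children w ++ ws)) n
    ≡⟨ cong (λ r → forestCount (length ws) (suc n) + forestCount r n)
            (trans (length-++ (children w)) (cong (_+ length ws) (children-length w≢[]))) ⟩
  forestCount (length ws) (suc n) + forestCount (2 + length ws) n
    ∎

-- Subtrees containing the root

below-root : ∀ s → Below ([] ∷ []) s
below-root s = here ([]≼ s)

path-snoc : ∀ {S a b c} → PathIn S a b → Adj b c → c ∈ S → PathIn S a c
path-snoc here         b~c c∈S = step b~c c∈S here
path-snoc (step e m p) b~c c∈S = step e m (path-snoc p b~c c∈S)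

path-from-root : ∀ {S} u → (∀ {s} → s ≼ u → s ∈ S) → PathIn S [] u
path-from-root []      _   = here
path-from-root (x ∷ u) anc = path-snoc (path-from-root u (λ s≼u → anc (≼-∷ s≼u))) (down x u) (anc ≼-refl)

path-ancestor : ∀ {S a b s} → PathIn S a b → s ≼ b → s ≼ a ⊎ s ∈ S
path-ancestor here s≼b = inj₁ s≼b
path-ancestor (step (down x a) c∈S p) s≼b with path-ancestor p s≼b
... | inj₂ s∈S         = inj₂ s∈S
... | inj₁ ≼-refl      = inj₂ c∈S
... | inj₁ (≼-∷ s≼a)   = inj₁ s≼a
path-ancestor (step (up x c) _ p) s≼b with path-ancestor p s≼b
... | inj₂ s∈S = inj₂ s∈S
... | inj₁ s≼c = inj₁ (≼-∷ s≼c)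

subtree⇒planted : ∀ {k S} → IsSubtreeAt k [] S → PlantedAt ([] ∷ []) S
subtree⇒planted {S = S} (rd , uq , _ , []∈S , paths) = record
  { reduced = rd ; unique = uq ; below = All.tabulate (λ {u} _ → below-root u)
  ; closed  = λ u∈S s≼u _ →
      [ (λ s≼[] → subst (_∈ S) (sym (≼[]⇒≡[] s≼[])) []∈S) , id ]′ (path-ancestor (paths u∈S) s≼u)
  }

planted⇒subtree : ∀ {k S} → PlantedAt ([] ∷ []) S → length S ≡ suc k → IsSubtreeAt (suc k) [] S
planted⇒subtree {S = []}    _ ()
planted⇒subtree {S = u ∷ _} p |S|≡ =
  reduced , unique , |S|≡ , closed (here refl) ([]≼ u) (below-root []) ,
  λ {u′} u′∈S → path-from-root u′ (λ s≼u′ → closed u′∈S s≼u′ (below-root _))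
  where open PlantedAt p

antichain-root : Antichain ([] ∷ [])
antichain-root = red-[] ∷ [] , [] ∷ []

forestsAt-root : ∀ m → Enumerates (suc m) [] (forestsAt ([] ∷ []) (suc m))
forestsAt-root m =
  All.tabulate (λ T∈ → uncurry planted⇒subtree (forestsAt-sound ([] ∷ []) (suc m) antichain-root T∈)) ,
  forestsAt-distinct ([] ∷ []) (suc m) antichain-root ,
  λ { S sub@(_ , _ , |S|≡ , _) → forestsAt-complete ([] ∷ []) (suc m) antichain-root (subtree⇒planted sub) |S|≡ }

forestsAt-root-length : ∀ m → length (forestsAt ([] ∷ []) (suc m)) ≡ forestCount 3 m
forestsAt-root-length m =
  trans (length-map ([] ∷_) (forestsAt (children [] ++ []) m))
        (forestsAt-length (children [] ++ []) m (Allₚ.++⁺ (children-nonempty []) []))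

-- Right multiplications are automorphisms

-- A word x₁ ∷ ⋯ ∷ xₙ ∷ [] is the element x₁⋯xₙ of ℤ/2 * ℤ/2 * ℤ/2, and x ◃ v and u ⋆ y are the products
-- x·v and u·y. Edges join v to x·v, so right multiplications preserve adjacency.
_◃_ : Fin 3 → Word → Word
x ◃ []      = x ∷ []
x ◃ (y ∷ v) with x ≟ y
... | yes _ = v
... | no  _ = x ∷ y ∷ v

adj-sym : ∀ {a c} → Adj a c → Adj c a
adj-sym (down x u) = up x u
adj-sym (up x u)   = down x u

◃-adj : ∀ x v → Adj v (x ◃ v)
◃-adj x []      = down x []
◃-adj x (y ∷ v) with x ≟ y
... | yes refl = up x v
... | no  _    = down x (y ∷ v)

◃-fresh : ∀ {x v} → Fresh v x → x ◃ v ≡ x ∷ v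
◃-fresh {v = []}        _   = refl
◃-fresh {x} {y ∷ v} x≢y with x ≟ y
... | yes x≡y = ⊥-elim (x≢y x≡y)
... | no  _   = refl

x◃x∷v≡v : ∀ x v → x ◃ (x ∷ v) ≡ v
x◃x∷v≡v x v with x ≟ x
... | yes _   = refl
... | no  x≢x = ⊥-elim (x≢x refl)

◃-reduced : ∀ x {v} → Reduced v → Reduced (x ◃ v)
◃-reduced x {[]}    _ = red-[x] x
◃-reduced x {y ∷ v} r with x ≟ y
... | yes _   = reduced-tail r
... | no  x≢y = reduced-∷ r x≢y

◃-involutive : ∀ x {v} → Reduced v → x ◃ (x ◃ v) ≡ v
◃-involutive x {[]}    _ = x◃x∷v≡v x []
◃-involutive x {y ∷ v} r with x ≟ y
... | yes refl = ◃-fresh (reduced⇒fresh r)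
... | no  _    = x◃x∷v≡v x (y ∷ v)

_⋆_ : Word → Fin 3 → Word
[]      ⋆ y = y ∷ []
(x ∷ u) ⋆ y = x ◃ (u ⋆ y)

⋆-reduced : ∀ u y → Reduced (u ⋆ y)
⋆-reduced []      y = red-[x] y
⋆-reduced (x ∷ u) y = ◃-reduced x (⋆-reduced u y)

⋆-adj : ∀ y {a c} → Adj a c → Adj (a ⋆ y) (c ⋆ y)
⋆-adj y (down x u) = ◃-adj x (u ⋆ y)
⋆-adj y (up x u)   = adj-sym (◃-adj x (u ⋆ y))

◃-⋆ : ∀ x v y → (x ◃ v) ⋆ y ≡ x ◃ (v ⋆ y)
◃-⋆ x []      y = refl
◃-⋆ x (z ∷ v) y with x ≟ z
... | yes refl = sym (◃-involutive x (⋆-reduced v y))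
... | no  _    = refl

⋆-involutive : ∀ y {u} → Reduced u → (u ⋆ y) ⋆ y ≡ u
⋆-involutive y {[]}    _ = x◃x∷v≡v y []
⋆-involutive y {x ∷ u} r = begin
  (x ◃ (u ⋆ y)) ⋆ y   ≡⟨ ◃-⋆ x (u ⋆ y) y ⟩
  x ◃ ((u ⋆ y) ⋆ y)   ≡⟨ cong (x ◃_) (⋆-involutive y (reduced-tail r)) ⟩
  x ◃ u               ≡⟨ ◃-fresh (reduced⇒fresh r) ⟩
  x ∷ u               ∎

reduced-++ˡ : ∀ p {q} → Reduced (p ++ q) → Reduced p
reduced-++ˡ []          _             = red-[]
reduced-++ˡ (x ∷ [])    _             = red-[x] x
reduced-++ˡ (x ∷ y ∷ p) (red-∷ x≢y r) = red-∷ x≢y (reduced-++ˡ (y ∷ p) r)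

⋆-∷ʳ : ∀ {w a} → Reduced (w ∷ʳ a) → w ⋆ a ≡ w ∷ʳ a
⋆-∷ʳ {[]}    _ = refl
⋆-∷ʳ {x ∷ w} r = trans (cong (x ◃_) (⋆-∷ʳ (reduced-tail r))) (◃-fresh (reduced⇒fresh r))

_·_ : Word → Word → Word
_·_ = foldl _⋆_

·-reduced : ∀ v {u} → Reduced u → Reduced (u · v)
·-reduced []      r = r
·-reduced (a ∷ v) {u} _ = ·-reduced v (⋆-reduced u a)

·-adj : ∀ v {a c} → Adj a c → Adj (a · v) (c · v)
·-adj []      p = p
·-adj (y ∷ v) p = ·-adj v (⋆-adj y p)

·-++ : ∀ v w → Reduced (w ++ v) → w · v ≡ w ++ v
·-++ []      w _ = sym (++-identityʳ w)
·-++ (a ∷ v) w r = begin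
  (w ⋆ a) · v     ≡⟨ cong (_· v) (⋆-∷ʳ (reduced-++ˡ (w ∷ʳ a) r′)) ⟩
  (w ∷ʳ a) · v    ≡⟨ ·-++ v (w ∷ʳ a) r′ ⟩
  (w ∷ʳ a) ++ v   ≡⟨ ++-assoc w (a ∷ []) v ⟩
  w ++ a ∷ v      ∎
  where
  r′ : Reduced ((w ∷ʳ a) ++ v)
  r′ = subst Reduced (sym (++-assoc w (a ∷ []) v)) r

[]·v≡v : ∀ {v} → Reduced v → [] · v ≡ v
[]·v≡v {v} = ·-++ v []

·-inverseʳ : ∀ v {u} → Reduced u → (u · v) · reverse v ≡ u
·-inverseʳ []      r = refl
·-inverseʳ (a ∷ v) {u} r = begin
  ((u ⋆ a) · v) · reverse (a ∷ v)   ≡⟨ cong (((u ⋆ a) · v) ·_) (unfold-reverse a v) ⟩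
  ((u ⋆ a) · v) · (reverse v ∷ʳ a)  ≡⟨ foldl-∷ʳ _⋆_ ((u ⋆ a) · v) a (reverse v) ⟩
  (((u ⋆ a) · v) · reverse v) ⋆ a   ≡⟨ cong (_⋆ a) (·-inverseʳ v (⋆-reduced u a)) ⟩
  (u ⋆ a) ⋆ a                       ≡⟨ ⋆-involutive a r ⟩
  u                                 ∎

·-inverseˡ : ∀ v {u} → Reduced u → (u · reverse v) · v ≡ u
·-inverseˡ v {u} r = begin
  (u · reverse v) · v                    ≡⟨ cong ((u · reverse v) ·_) (reverse-involutive v) ⟨
  (u · reverse v) · reverse (reverse v)  ≡⟨ ·-inverseʳ (reverse v) r ⟩
  u                                      ∎

allPairs-mapWithAll : ∀ {A : Set} {P : A → Set} {R Q : A → A → Set} {xs} →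
                      (∀ {x y} → P x → P y → R x y → Q x y) → All P xs → AllPairs R xs → AllPairs Q xs
allPairs-mapWithAll f []         []         = []
allPairs-mapWithAll f (px ∷ pxs) (rx ∷ rxs) =
  All.zipWith (λ (r , py) → f px py r) (rx , pxs) ∷ allPairs-mapWithAll f pxs rxs

module Embedding (f g : Word → Word)
  (f-reduced : ∀ {u} → Reduced u → Reduced (f u))
  (f-adj : ∀ {a c} → Adj a c → Adj (f a) (f c))
  (g∘f : ∀ {u} → Reduced u → g (f u) ≡ u)
  where

  pathIn-map : ∀ {S a b} → PathIn S a b → PathIn (map f S) (f a) (f b)
  pathIn-map here             = here
  pathIn-map (step a~c c∈S p) = step (f-adj a~c) (∈-map⁺ f c∈S) (pathIn-map p)

  unique-map : ∀ {S} → All Reduced S → Unique S → Unique (map f S)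
  unique-map rd uq = AllPairsₚ.map⁺
    (allPairs-mapWithAll (λ ru rt u≢t fu≡ft → u≢t (trans (sym (g∘f ru)) (trans (cong g fu≡ft) (g∘f rt)))) rd uq)

  subtree-map : ∀ {k a S} → IsSubtreeAt k a S → IsSubtreeAt k (f a) (map f S)
  subtree-map {k} {a} {S} (rd , uq , |S|≡ , a∈S , paths) =
    Allₚ.map⁺ (All.map f-reduced rd) , unique-map rd uq , trans (length-map f S) |S|≡ , ∈-map⁺ f a∈S ,
    λ u∈ → let (_ , u∈S , eq) = ∈-map⁻ f u∈ in subst (PathIn (map f S) (f a)) (sym eq) (pathIn-map (paths u∈S))

  map-inverse : ∀ {S} → All Reduced S → map g (map f S) ≡ S
  map-inverse []       = refl
  map-inverse (r ∷ rs) = cong₂ _∷_ (g∘f r) (map-inverse rs)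

  ↭-reflect : ∀ {S T} → All Reduced S → All Reduced T → map f S ↭ map f T → S ↭ T
  ↭-reflect rS rT ρ = subst₂ _↭_ (map-inverse rS) (map-inverse rT) (↭ₚ.map⁺ g ρ)

module Automorphism (f g : Word → Word)
  (f-reduced : ∀ {u} → Reduced u → Reduced (f u))
  (g-reduced : ∀ {u} → Reduced u → Reduced (g u))
  (f-adj : ∀ {a c} → Adj a c → Adj (f a) (f c))
  (g-adj : ∀ {a c} → Adj a c → Adj (g a) (g c))
  (g∘f : ∀ {u} → Reduced u → g (f u) ≡ u)
  (f∘g : ∀ {u} → Reduced u → f (g u) ≡ u)
  where

  private
    module F = Embedding f g f-reduced f-adj g∘f
    module G = Embedding g f g-reduced g-adj f∘g

  enumerates-map : ∀ {k a Ts} → Reduced a → Enumerates k a Ts → Enumerates k (f a) (map (map f) Ts)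
  enumerates-map {k} {a} {Ts} ra (subtrees , distinct , complete) =
    Allₚ.map⁺ (All.map F.subtree-map subtrees) ,
    AllPairsₚ.map⁺ (allPairs-mapWithAll (λ rS rT ¬S↭T fS↭fT → ¬S↭T (F.↭-reflect rS rT fS↭fT))
                                         (All.map proj₁ subtrees) distinct) ,
    complete′
    where
    complete′ : ∀ S → IsSubtreeAt k (f a) S → ∃ λ T → T ∈ map (map f) Ts × S ↭ T
    complete′ S sub =
      let (T , T∈ , gS↭T) = complete (map g S) (subst (λ b → IsSubtreeAt k b (map g S)) (g∘f ra) (G.subtree-map sub))
      in map f T , ∈-map⁺ (map f) T∈ , subst (_↭ map f T) (G.map-inverse (proj₁ sub)) (↭ₚ.map⁺ f gS↭T)

enumerates-translate : ∀ {k Ts} v → Reduced v → Enumerates k [] Ts → Enumerates k v (map (map (_· v)) Ts)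
enumerates-translate {k} {Ts} v rv E =
  subst (λ a → Enumerates k a (map (map (_· v)) Ts)) ([]·v≡v rv) (enumerates-map red-[] E)
  where
  open Automorphism (_· v) (_· reverse v) (·-reduced v) (·-reduced (reverse v)) (·-adj v) (·-adj (reverse v))
                    (·-inverseʳ v) (·-inverseˡ v)

mainTheorem7 : (k : ℕ) → 1 ≤ k → (v : Word) → Reduced v →
    Σ (List (List Word)) λ Ts → Enumerates k v Ts ×
      length Ts ≡ (3 * ((2 * k + 1) C (k ∸ 1))) / suc (2 * k) ×
      length Ts ≡ catalan (suc k) ∸ catalan k
mainTheorem7 zero    ()
mainTheorem7 (suc m) _ v rv =
  Ts , enumerates-translate v rv (forestsAt-root m) ,
  trans |Ts|≡ (forestCount-3-slots m) , trans |Ts|≡ (sym (catalan-difference m))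
  where
  Ts : List (List Word)
  Ts = map (map (_· v)) (forestsAt ([] ∷ []) (suc m))
  |Ts|≡ : length Ts ≡ forestCount 3 m
  |Ts|≡ = trans (length-map (map (_· v)) (forestsAt ([] ∷ []) (suc m))) (forestsAt-root-length m)
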